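{- A two-rooted Eulerian graph is \textbf{gcds}-sortable if and only if it has property $a$.
   Context: A two-rooted graph is a finite simple undirected graph $G=(V,E)$ with two designated roots $x,y$. A graph is Eulerian if every vertex has even degree. With $f_a(b)=1$ iff $a,b$ adjacent, $\textbf{gcds}_{\{p,q\}}(G)$ (for adjacent non-root $p,q$) is the graph on $V$ where distinct $s,t$ are adjacent iff $f_p(s)f_q(t)+f_q(s)f_p(t)+f_s(t)\equiv1\pmod 2$. $G$ is \textbf{gcds}-sortable if finitely many such operations yield the edgeless graph. A parity cut is a partition $V=V_1\cup V_2$ into disjoint sets such that every vertex (roots included) has an even number of neighbours in the part not containing it; $G$ has property $a$ if it has a parity cut with $x\in V_1$, $y\in V_2$. -}

module Defs where

open import Data.Nat using (ℕ; zero; suc; _+_)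
open import Data.Nat.Base using (_%_)
open import Data.Bool using (Bool; true; false; _∧_; _xor_; not; if_then_else_)
open import Data.Fin using (Fin)
open import Data.Fin.Properties using (_≟_)
open import Data.List using (List; filter; length)
open import Data.List.Base using (allFin)
open import Relation.Nullary using (¬_; Dec; yes; no)
open import Relation.Nullary.Decidable using (does)
open import Relation.Binary.PropositionalEquality using (_≡_)
open import Data.Product using (Σ; _×_; _,_)

record Graph (n : ℕ) : Set where
  constructor mkGraph
  field
    adj   : Fin n → Fin n → Bool
    sym   : ∀ a b → adj a b ≡ adj b a
    irrefl : ∀ a → adj a a ≡ false
open Graph public

record TwoRooted (n : ℕ) : Set where
  constructor mkTwoRooted
  field
    graph : Graph n
    x y   : Fin n
    x≢y   : ¬ (x ≡ y)
open TwoRooted public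

count : ∀ {n} → (Fin n → Bool) → ℕ
count {n} P = length (filter (λ b → P b ≡? true) (allFin n))
  where
  _≡?_ : (u v : Bool) → Dec (u ≡ v)
  false ≡? false = yes _≡_.refl
  false ≡? true  = no (λ ())
  true  ≡? false = no (λ ())
  true  ≡? true  = yes _≡_.refl

Even : ℕ → Set
Even m = m % 2 ≡ 0

degree : ∀ {n} → Graph n → Fin n → ℕ
degree G a = count (adj G a)

Eulerian : ∀ {n} → Graph n → Set
Eulerian {n} G = ∀ (a : Fin n) → Even (degree G a)

gcdsAdj : ∀ {n} → Graph n → Fin n → Fin n → Fin n → Fin n → Bool
gcdsAdj G p q s t with s ≟ t
... | yes _ = false
... | no _  = ((adj G p s ∧ adj G q t) xor (adj G q s ∧ adj G p t)) xor adj G s t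

data Step {n} (x y : Fin n) (G₁ G₂ : Graph n) : Set where
  step : (p q : Fin n) → ¬ (p ≡ x) → ¬ (p ≡ y) → ¬ (q ≡ x) → ¬ (q ≡ y)
       → adj G₁ p q ≡ true
       → (∀ s t → adj G₂ s t ≡ gcdsAdj G₁ p q s t)
       → Step x y G₁ G₂

Edgeless : ∀ {n} → Graph n → Set
Edgeless {n} G = ∀ (s t : Fin n) → adj G s t ≡ false

data SortsFrom {n} (x y : Fin n) : Graph n → Set where
  done : ∀ {G} → Edgeless G → SortsFrom x y G
  next : ∀ {G G'} → Step x y G G' → SortsFrom x y G' → SortsFrom x y G

GcdsSortable : ∀ {n} → TwoRooted n → Set
GcdsSortable R = SortsFrom (x R) (y R) (graph R)

-- a parity cut given as side : V → Bool (false = V₁, true = V₂):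
-- every vertex has an even number of neighbours in the other part
IsParityCut : ∀ {n} → Graph n → (Fin n → Bool) → Set
IsParityCut {n} G side =
  ∀ (a : Fin n) → Even (count (λ b → adj G a b ∧ (side a xor side b)))

PropertyA : ∀ {n} → TwoRooted n → Set
PropertyA {n} R = Σ (Fin n → Bool) λ side →
  IsParityCut (graph R) side × (side (x R) ≡ false) × (side (y R) ≡ true)

-- Work over GF(2) = (Bool, xor, ∧) with A the adjacency matrix. In an Eulerian graph the number
-- of neighbours of a on the other side of a cut c is c a · deg a + (A c) a ≡ (A c) a, so parity
-- cuts are exactly the kernel vectors of A, and property a says that some kernel vector is 0 at x
-- and 1 at y. The operation gcds_{p,q} is the rank-two update A + A_p A_qᵀ + A_q A_pᵀ; it maps
-- ker A into the new kernel, and c ↦ c + (A c)_q e_p + (A c)_p e_q maps the new kernel back into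
-- ker A. Both maps fix the values at the roots, so property a is invariant, and the edgeless graph
-- has it (take e_y). Conversely, while some edge pq avoids the roots, gcds_{p,q} isolates p and
-- keeps isolated vertices isolated, so the process terminates; once every edge meets a root, the
-- even degrees together with the kernel vector force every non-root vertex, and then x, to be
-- isolated.

module Submission where

open import Defs renaming (sym to adj-sym)
open import Algebra.Bundles using (CommutativeRing)
open import Data.Bool using (Bool; true; false; _∧_; _xor_; not)
open import Data.Bool.Properties
  using ( xor-∧-commutativeRing; ∧-identityʳ; ∧-zeroʳ; ∧-comm; ∧-assoc; ∧-distribˡ-xor; ∧-distribʳ-xor
        ; xor-assoc; xor-comm; xor-same; xor-identityʳ; ¬-not; not-¬; not-involutive)
  renaming (_≟_ to _≟ᵇ_)
open import Data.Empty using (⊥-elim)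
open import Data.Fin using (Fin; zero; suc)
open import Data.Fin.Properties using (_≟_; any?; all?)
open import Data.Fin.Subset using (Subset; _∈_; _⊂_; _⊃_)
open import Data.Fin.Subset.Induction using (⊃-wellFounded)
open import Data.List using (filter; length; tabulate)
open import Data.Nat using (ℕ; zero; suc)
open import Data.Product using (Σ; ∃; _×_; _,_; proj₁; proj₂)
open import Data.Sum using (_⊎_; inj₁; inj₂)
import Data.Vec as Vec
open import Data.Vec.Properties using (lookup⇒[]=; []=⇒lookup; lookup∘tabulate)
open import Function using (_∘_; _⟨_⟩_; const; id; _⇔_; mk⇔; Equivalence)
open import Induction.WellFounded using (Acc; acc)
open import Relation.Binary.PropositionalEquality
open import Relation.Nullary using (¬_; Dec; yes; no; does; ¬?; _×-dec_)
open import Relation.Nullary.Decidable using (dec-true; dec-false)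
open import Relation.Unary using (Decidable)

open import Algebra.Properties.Semiring.Sum (CommutativeRing.semiring xor-∧-commutativeRing)
  using (sum-syntax; ∑-distrib-+; *-distribˡ-sum; *-distribʳ-sum; sum-cong-≗; sum-replicate-zero)

private
  variable
    n : ℕ

δ : Fin n → Fin n → Bool
δ p t = does (p ≟ t)

∑-δ : (f : Fin n → Bool) (p : Fin n) → ∑[ t < n ] (f t ∧ δ p t) ≡ f p
∑-δ {suc n} f zero = begin
  (f zero ∧ true) xor ∑[ t < n ] (f (suc t) ∧ false)
    ≡⟨ cong₂ _xor_ (∧-identityʳ (f zero)) (sum-cong-≗ (∧-zeroʳ ∘ f ∘ suc)) ⟩
  f zero xor ∑[ t < n ] false
    ≡⟨ cong (f zero xor_) (sum-replicate-zero n) ⟩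
  f zero xor false
    ≡⟨ xor-identityʳ (f zero) ⟩
  f zero ∎
  where open ≡-Reasoning
∑-δ {suc n} f (suc p) = cong (_xor ∑[ t < n ] (f (suc t) ∧ δ p t)) (∧-zeroʳ (f zero)) ⟨ trans ⟩ ∑-δ (f ∘ suc) p

∑-supportedOn₂ : {x y : Fin n} → x ≢ y → (f : Fin n → Bool)
  → (∀ t → t ≢ x → t ≢ y → f t ≡ false) → ∑[ t < n ] f t ≡ f x xor f y
∑-supportedOn₂ {n} {x} {y} x≢y f vanishes = begin
  ∑[ t < n ] f t
    ≡⟨ sum-cong-≗ split ⟩
  ∑[ t < n ] ((f t ∧ δ x t) xor (f t ∧ δ y t))
    ≡⟨ ∑-distrib-+ (λ t → f t ∧ δ x t) (λ t → f t ∧ δ y t) ⟩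
  ∑[ t < n ] (f t ∧ δ x t) xor ∑[ t < n ] (f t ∧ δ y t)
    ≡⟨ cong₂ _xor_ (∑-δ f x) (∑-δ f y) ⟩
  f x xor f y ∎
  where
  open ≡-Reasoning
  split : ∀ t → f t ≡ (f t ∧ δ x t) xor (f t ∧ δ y t)
  split t with x ≟ t | y ≟ t
  ... | yes refl | yes refl = ⊥-elim (x≢y refl)
  ... | yes _    | no _     = sym (cong₂ _xor_ (∧-identityʳ (f t)) (∧-zeroʳ (f t)) ⟨ trans ⟩ xor-identityʳ (f t))
  ... | no _     | yes _    = sym (cong (_xor (f t ∧ true)) (∧-zeroʳ (f t)) ⟨ trans ⟩ ∧-identityʳ (f t))
  ... | no x≢t   | no y≢t   =
    vanishes t (x≢t ∘ sym) (y≢t ∘ sym) ⟨ trans ⟩ sym (cong₂ _xor_ (∧-zeroʳ (f t)) (∧-zeroʳ (f t)))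

odd : ℕ → Bool
odd zero    = false
odd (suc m) = not (odd m)

even⇒odd≡false : ∀ m → Even m → odd m ≡ false
even⇒odd≡false zero          _ = refl
even⇒odd≡false (suc (suc m)) e = trans (not-involutive (odd m)) (even⇒odd≡false m e)

odd≡false⇒even : ∀ m → odd m ≡ false → Even m
odd≡false⇒even zero          _ = refl
odd≡false⇒even (suc zero)    ()
odd≡false⇒even (suc (suc m)) e = odd≡false⇒even m (trans (sym (not-involutive (odd m))) e)

odd-length-filter : (P : Fin n → Bool) (P? : Decidable (λ b → P b ≡ true)) {k : ℕ} (g : Fin k → Fin n)
  → odd (length (filter P? (tabulate g))) ≡ ∑[ i < k ] P (g i)
odd-length-filter P P? {zero}  g = refl
odd-length-filter P P? {suc k} g with P? (g zero)
... | yes Pg≡true rewrite Pg≡true = cong not (odd-length-filter P P? (g ∘ suc))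
... | no  Pg≢true rewrite ¬-not Pg≢true = odd-length-filter P P? (g ∘ suc)

even-count⇔ : (P : Fin n → Bool) → Even (count P) ⇔ (∑[ b < n ] P b ≡ false)
even-count⇔ P = mk⇔
  (λ even → trans (sym odd-count) (even⇒odd≡false (count P) even))
  (λ ∑P≡false → odd≡false⇒even (count P) (trans odd-count ∑P≡false))
  where
  odd-count : odd (count P) ≡ ∑[ b < _ ] P b
  odd-count = odd-length-filter P _ id

neighbourSum : Graph n → (Fin n → Bool) → Fin n → Bool
neighbourSum {n} G c a = ∑[ b < n ] (adj G a b ∧ c b)

InKernel : Graph n → (Fin n → Bool) → Set
InKernel {n} G c = ∀ (a : Fin n) → neighbourSum G c a ≡ false

neighbourSum-ones : (G : Graph n) (a : Fin n) → neighbourSum G (const true) a ≡ ∑[ b < n ] adj G a b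
neighbourSum-ones G a = sum-cong-≗ (∧-identityʳ ∘ adj G a)

eulerian⇒ones∈kernel : (G : Graph n) → Eulerian G → InKernel G (const true)
eulerian⇒ones∈kernel G eulerian a =
  trans (neighbourSum-ones G a) (Equivalence.to (even-count⇔ (adj G a)) (eulerian a))

crossingSum≡neighbourSum : (G : Graph n) → InKernel G (const true) → (s : Fin n → Bool) (a : Fin n)
  → ∑[ b < n ] (adj G a b ∧ (s a xor s b)) ≡ neighbourSum G s a
crossingSum≡neighbourSum {n} G ones∈kernel s a = begin
  ∑[ b < n ] (adj G a b ∧ (s a xor s b))
    ≡⟨ sum-cong-≗ (λ b → ∧-distribˡ-xor (adj G a b) (s a) (s b)) ⟩
  ∑[ b < n ] ((adj G a b ∧ s a) xor (adj G a b ∧ s b))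
    ≡⟨ ∑-distrib-+ (λ b → adj G a b ∧ s a) (λ b → adj G a b ∧ s b) ⟩
  ∑[ b < n ] (adj G a b ∧ s a) xor neighbourSum G s a
    ≡⟨ cong (_xor neighbourSum G s a) (*-distribʳ-sum (s a) (adj G a)) ⟨
  (∑[ b < n ] adj G a b ∧ s a) xor neighbourSum G s a
    ≡⟨ cong (λ d → (d ∧ s a) xor neighbourSum G s a) (sym (neighbourSum-ones G a) ⟨ trans ⟩ ones∈kernel a) ⟩
  neighbourSum G s a ∎
  where open ≡-Reasoning

parityCut⇔InKernel : (G : Graph n) → InKernel G (const true) → (s : Fin n → Bool)
  → IsParityCut G s ⇔ InKernel G s
parityCut⇔InKernel G ones∈kernel s = mk⇔
  (λ cut a → trans (sym (crossing a)) (Equivalence.to (even-count⇔ (crossingEdge a)) (cut a)))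
  (λ s∈kernel a → Equivalence.from (even-count⇔ (crossingEdge a)) (trans (crossing a) (s∈kernel a)))
  where
  crossingEdge : Fin _ → Fin _ → Bool
  crossingEdge a b = adj G a b ∧ (s a xor s b)
  crossing : ∀ a → ∑[ b < _ ] crossingEdge a b ≡ neighbourSum G s a
  crossing = crossingSum≡neighbourSum G ones∈kernel s

gcdsAdj-expand : (G : Graph n) (p q s t : Fin n)
  → gcdsAdj G p q s t ≡ ((adj G p s ∧ adj G q t) xor (adj G q s ∧ adj G p t)) xor adj G s t
gcdsAdj-expand G p q s t with s ≟ t
... | no  _    = refl
... | yes refl = sym (begin
  ((adj G p s ∧ adj G q s) xor (adj G q s ∧ adj G p s)) xor adj G s s
    ≡⟨ cong₂ (λ u v → (u xor (adj G q s ∧ adj G p s)) xor v) (∧-comm (adj G p s) (adj G q s)) (irrefl G s) ⟩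
  ((adj G q s ∧ adj G p s) xor (adj G q s ∧ adj G p s)) xor false
    ≡⟨ cong (_xor false) (xor-same (adj G q s ∧ adj G p s)) ⟩
  false ∎)
  where open ≡-Reasoning

gcdsGraph : Graph n → Fin n → Fin n → Graph n
gcdsGraph G p q = mkGraph (gcdsAdj G p q) symmetric loopless
  where
  symmetric : ∀ s t → gcdsAdj G p q s t ≡ gcdsAdj G p q t s
  symmetric s t = begin
    gcdsAdj G p q s t
      ≡⟨ gcdsAdj-expand G p q s t ⟩
    ((adj G p s ∧ adj G q t) xor (adj G q s ∧ adj G p t)) xor adj G s t
      ≡⟨ cong₂ _xor_ (xor-comm (adj G p s ∧ adj G q t) (adj G q s ∧ adj G p t)) (adj-sym G s t) ⟩
    ((adj G q s ∧ adj G p t) xor (adj G p s ∧ adj G q t)) xor adj G t s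
      ≡⟨ cong (_xor adj G t s) (cong₂ _xor_ (∧-comm (adj G q s) (adj G p t)) (∧-comm (adj G p s) (adj G q t))) ⟩
    ((adj G p t ∧ adj G q s) xor (adj G q t ∧ adj G p s)) xor adj G t s
      ≡⟨ gcdsAdj-expand G p q t s ⟨
    gcdsAdj G p q t s ∎
    where open ≡-Reasoning
  loopless : ∀ s → gcdsAdj G p q s s ≡ false
  loopless s with s ≟ s
  ... | yes _   = refl
  ... | no  s≢s = ⊥-elim (s≢s refl)

record IsGcds (G : Graph n) (p q : Fin n) (G′ : Graph n) : Set where
  constructor isGcds
  field
    adj-gcds : ∀ s t → adj G′ s t ≡ gcdsAdj G p q s t

neighbourSum-gcds : {G G′ : Graph n} {p q : Fin n} → IsGcds G p q G′ → (c : Fin n → Bool) (a : Fin n)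
  → neighbourSum G′ c a
    ≡ ((adj G p a ∧ neighbourSum G c q) xor (adj G q a ∧ neighbourSum G c p)) xor neighbourSum G c a
neighbourSum-gcds {n} {G} {G′} {p} {q} (isGcds G′≡gcds) c a = begin
  ∑[ b < n ] (adj G′ a b ∧ c b)
    ≡⟨ sum-cong-≗ (λ b → cong (_∧ c b) (trans (G′≡gcds a b) (gcdsAdj-expand G p q a b))) ⟩
  ∑[ b < n ] ((((P a ∧ Q b) xor (Q a ∧ P b)) xor A a b) ∧ c b)
    ≡⟨ sum-cong-≗ (λ b → distribute (P a) (Q b) (Q a) (P b) (A a b) (c b)) ⟩
  ∑[ b < n ] (((P a ∧ (Q b ∧ c b)) xor (Q a ∧ (P b ∧ c b))) xor (A a b ∧ c b))
    ≡⟨ ∑-distrib-+ (λ b → (P a ∧ (Q b ∧ c b)) xor (Q a ∧ (P b ∧ c b))) (λ b → A a b ∧ c b) ⟩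
  ∑[ b < n ] ((P a ∧ (Q b ∧ c b)) xor (Q a ∧ (P b ∧ c b))) xor neighbourSum G c a
    ≡⟨ cong (_xor neighbourSum G c a) (∑-distrib-+ (λ b → P a ∧ (Q b ∧ c b)) (λ b → Q a ∧ (P b ∧ c b))) ⟩
  (∑[ b < n ] (P a ∧ (Q b ∧ c b)) xor ∑[ b < n ] (Q a ∧ (P b ∧ c b))) xor neighbourSum G c a
    ≡⟨ cong (_xor neighbourSum G c a)
         (cong₂ _xor_ (*-distribˡ-sum (P a) (λ b → Q b ∧ c b)) (*-distribˡ-sum (Q a) (λ b → P b ∧ c b))) ⟨
  ((P a ∧ neighbourSum G c q) xor (Q a ∧ neighbourSum G c p)) xor neighbourSum G c a ∎
  where
  open ≡-Reasoning
  A : Fin n → Fin n → Bool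
  A = adj G
  P Q : Fin n → Bool
  P = adj G p
  Q = adj G q
  distribute : ∀ u v w z e f → (((u ∧ v) xor (w ∧ z)) xor e) ∧ f ≡ ((u ∧ (v ∧ f)) xor (w ∧ (z ∧ f))) xor (e ∧ f)
  distribute u v w z e f =
    ∧-distribʳ-xor f ((u ∧ v) xor (w ∧ z)) e ⟨ trans ⟩
    cong (_xor (e ∧ f)) (∧-distribʳ-xor f (u ∧ v) (w ∧ z) ⟨ trans ⟩ cong₂ _xor_ (∧-assoc u v f) (∧-assoc w z f))

InKernel-gcds : {G G′ : Graph n} {p q : Fin n} → IsGcds G p q G′ → {c : Fin n → Bool}
  → InKernel G c → InKernel G′ c
InKernel-gcds {G = G} {G′} {p} {q} gcds {c} c∈kernel a = begin
  neighbourSum G′ c a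
    ≡⟨ neighbourSum-gcds gcds c a ⟩
  ((adj G p a ∧ neighbourSum G c q) xor (adj G q a ∧ neighbourSum G c p)) xor neighbourSum G c a
    ≡⟨ cong₂ _xor_ (cong₂ (λ u v → (adj G p a ∧ u) xor (adj G q a ∧ v)) (c∈kernel q) (c∈kernel p)) (c∈kernel a) ⟩
  ((adj G p a ∧ false) xor (adj G q a ∧ false)) xor false
    ≡⟨ cong (_xor false) (cong₂ _xor_ (∧-zeroʳ (adj G p a)) (∧-zeroʳ (adj G q a))) ⟩
  false ∎
  where open ≡-Reasoning

pullback : Graph n → Fin n → Fin n → (Fin n → Bool) → Fin n → Bool
pullback G p q c b = (c b xor (neighbourSum G c q ∧ δ p b)) xor (neighbourSum G c p ∧ δ q b)

neighbourSum-pullback : (G : Graph n) (p q : Fin n) (c : Fin n → Bool) (a : Fin n)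
  → neighbourSum G (pullback G p q c) a
    ≡ (neighbourSum G c a xor (adj G a p ∧ neighbourSum G c q)) xor (adj G a q ∧ neighbourSum G c p)
neighbourSum-pullback {n} G p q c a = begin
  ∑[ b < n ] (A b ∧ ((c b xor (u ∧ δ p b)) xor (v ∧ δ q b)))
    ≡⟨ sum-cong-≗ (λ b → distribute (A b) (c b) u (δ p b) v (δ q b)) ⟩
  ∑[ b < n ] (((A b ∧ c b) xor ((A b ∧ u) ∧ δ p b)) xor ((A b ∧ v) ∧ δ q b))
    ≡⟨ ∑-distrib-+ (λ b → (A b ∧ c b) xor ((A b ∧ u) ∧ δ p b)) (λ b → (A b ∧ v) ∧ δ q b) ⟩
  ∑[ b < n ] ((A b ∧ c b) xor ((A b ∧ u) ∧ δ p b)) xor ∑[ b < n ] ((A b ∧ v) ∧ δ q b)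
    ≡⟨ cong₂ _xor_ (∑-distrib-+ (λ b → A b ∧ c b) (λ b → (A b ∧ u) ∧ δ p b)) (∑-δ (λ b → A b ∧ v) q) ⟩
  (neighbourSum G c a xor ∑[ b < n ] ((A b ∧ u) ∧ δ p b)) xor (A q ∧ v)
    ≡⟨ cong (λ d → (neighbourSum G c a xor d) xor (A q ∧ v)) (∑-δ (λ b → A b ∧ u) p) ⟩
  (neighbourSum G c a xor (A p ∧ u)) xor (A q ∧ v) ∎
  where
  open ≡-Reasoning
  A : Fin n → Bool
  A = adj G a
  u v : Bool
  u = neighbourSum G c q
  v = neighbourSum G c p
  distribute : ∀ e f g h i j → e ∧ ((f xor (g ∧ h)) xor (i ∧ j)) ≡ ((e ∧ f) xor ((e ∧ g) ∧ h)) xor ((e ∧ i) ∧ j)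
  distribute e f g h i j =
    ∧-distribˡ-xor e (f xor (g ∧ h)) (i ∧ j) ⟨ trans ⟩
    cong₂ _xor_ (∧-distribˡ-xor e f (g ∧ h) ⟨ trans ⟩ cong ((e ∧ f) xor_) (sym (∧-assoc e g h)))
                (sym (∧-assoc e i j))

InKernel-pullback : {G G′ : Graph n} {p q : Fin n} → IsGcds G p q G′ → {c : Fin n → Bool}
  → InKernel G′ c → InKernel G (pullback G p q c)
InKernel-pullback {G = G} {G′} {p} {q} gcds {c} c∈kernel a = begin
  neighbourSum G (pullback G p q c) a
    ≡⟨ neighbourSum-pullback G p q c a ⟩
  (N a xor (adj G a p ∧ N q)) xor (adj G a q ∧ N p)
    ≡⟨ cong₂ (λ d e → (N a xor (d ∧ N q)) xor (e ∧ N p)) (adj-sym G a p) (adj-sym G a q) ⟩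
  (N a xor (adj G p a ∧ N q)) xor (adj G q a ∧ N p)
    ≡⟨ xor-assoc (N a) (adj G p a ∧ N q) (adj G q a ∧ N p) ⟨ trans ⟩
       xor-comm (N a) ((adj G p a ∧ N q) xor (adj G q a ∧ N p)) ⟩
  ((adj G p a ∧ N q) xor (adj G q a ∧ N p)) xor N a
    ≡⟨ neighbourSum-gcds gcds c a ⟨
  neighbourSum G′ c a
    ≡⟨ c∈kernel a ⟩
  false ∎
  where
  open ≡-Reasoning
  N : Fin _ → Bool
  N = neighbourSum G c

pullback-fixes : (G : Graph n) {p q r : Fin n} → r ≢ p → r ≢ q → (c : Fin n → Bool) → pullback G p q c r ≡ c r
pullback-fixes G {p} {q} {r} r≢p r≢q c = begin
  (c r xor (neighbourSum G c q ∧ δ p r)) xor (neighbourSum G c p ∧ δ q r)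
    ≡⟨ cong₂ (λ d e → (c r xor (neighbourSum G c q ∧ d)) xor (neighbourSum G c p ∧ e))
         (dec-false (p ≟ r) (r≢p ∘ sym)) (dec-false (q ≟ r) (r≢q ∘ sym)) ⟩
  (c r xor (neighbourSum G c q ∧ false)) xor (neighbourSum G c p ∧ false)
    ≡⟨ cong₂ (λ d e → (c r xor d) xor e) (∧-zeroʳ (neighbourSum G c q)) (∧-zeroʳ (neighbourSum G c p)) ⟩
  (c r xor false) xor false
    ≡⟨ xor-identityʳ (c r xor false) ⟨ trans ⟩ xor-identityʳ (c r) ⟩
  c r ∎
  where open ≡-Reasoning

NonRoot : Fin n → Fin n → Fin n → Set
NonRoot x y v = v ≢ x × v ≢ y

KernelSeparates : Graph n → Fin n → Fin n → Set
KernelSeparates {n} G x y = Σ (Fin n → Bool) λ c → InKernel G c × c x ≡ false × c y ≡ true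

propertyA⇔KernelSeparates : (R : TwoRooted n) → InKernel (graph R) (const true)
  → PropertyA R ⇔ KernelSeparates (graph R) (x R) (y R)
propertyA⇔KernelSeparates R ones∈kernel = mk⇔
  (λ (side , cut , sx , sy) → side , Equivalence.to (cut⇔kernel side) cut , sx , sy)
  (λ (c , c∈kernel , cx , cy) → c , Equivalence.from (cut⇔kernel c) c∈kernel , cx , cy)
  where
  cut⇔kernel : ∀ s → IsParityCut (graph R) s ⇔ InKernel (graph R) s
  cut⇔kernel = parityCut⇔InKernel (graph R) ones∈kernel

KernelSeparates-gcds : {G G′ : Graph n} {p q x y : Fin n} → IsGcds G p q G′
  → KernelSeparates G x y → KernelSeparates G′ x y
KernelSeparates-gcds gcds (c , c∈kernel , cx , cy) =
  c , InKernel-gcds gcds c∈kernel , cx , cy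

KernelSeparates-pullback : {G G′ : Graph n} {p q x y : Fin n} → IsGcds G p q G′
  → NonRoot x y p → NonRoot x y q → KernelSeparates G′ x y → KernelSeparates G x y
KernelSeparates-pullback {G = G} {p = p} {q} gcds (p≢x , p≢y) (q≢x , q≢y) (c , c∈kernel , cx , cy) =
    pullback G p q c
  , InKernel-pullback gcds c∈kernel
  , trans (pullback-fixes G (p≢x ∘ sym) (q≢x ∘ sym) c) cx
  , trans (pullback-fixes G (p≢y ∘ sym) (q≢y ∘ sym) c) cy

edgeless⇒KernelSeparates : (G : Graph n) {x y : Fin n} → x ≢ y → Edgeless G → KernelSeparates G x y
edgeless⇒KernelSeparates G {x} {y} x≢y edgeless =
  δ y , (λ a → trans (∑-δ (adj G a) y) (edgeless a y)) , dec-false (y ≟ x) (x≢y ∘ sym) , dec-true (y ≟ y) refl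

sortable⇒KernelSeparates : {G : Graph n} {x y : Fin n} → x ≢ y → SortsFrom x y G → KernelSeparates G x y
sortable⇒KernelSeparates {G = G} x≢y (done edgeless) = edgeless⇒KernelSeparates G x≢y edgeless
sortable⇒KernelSeparates {G = G} x≢y (next {G' = G′} (step p q p≢x p≢y q≢x q≢y _ G′≡gcds) sorts) =
  KernelSeparates-pullback {G = G} {G′} (isGcds G′≡gcds) (p≢x , p≢y) (q≢x , q≢y)
    (sortable⇒KernelSeparates x≢y sorts)

Isolated : Graph n → Fin n → Set
Isolated {n} G s = ∀ (t : Fin n) → adj G s t ≡ false

isolated? : (G : Graph n) → Decidable (Isolated G)
isolated? G s = all? (λ t → adj G s t ≟ᵇ false)

isolatedSet : Graph n → Subset n
isolatedSet G = Vec.tabulate (does ∘ isolated? G)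

isolated⇒∈isolatedSet : (G : Graph n) {s : Fin n} → Isolated G s → s ∈ isolatedSet G
isolated⇒∈isolatedSet G {s} isolated = lookup⇒[]= s (isolatedSet G)
  (lookup∘tabulate (does ∘ isolated? G) s ⟨ trans ⟩ dec-true (isolated? G s) isolated)

∈isolatedSet⇒isolated : (G : Graph n) {s : Fin n} → s ∈ isolatedSet G → Isolated G s
∈isolatedSet⇒isolated G {s} s∈isolatedSet =
  fromYes (isolated? G s) (sym (lookup∘tabulate (does ∘ isolated? G) s) ⟨ trans ⟩ []=⇒lookup s∈isolatedSet)
  where
  fromYes : (isolated? : Dec (Isolated G s)) → does isolated? ≡ true → Isolated G s
  fromYes (yes isolated) _ = isolated
  fromYes (no _)         ()

isolated-gcds : {G G′ : Graph n} {p q s : Fin n} → IsGcds G p q G′ → Isolated G s → Isolated G′ s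
isolated-gcds {G = G} {p = p} {q} {s} (isGcds G′≡gcds) isolated t
  rewrite G′≡gcds s t | gcdsAdj-expand G p q s t | adj-sym G p s | adj-sym G q s
        | isolated p | isolated q | isolated t = refl

isolated-gcds-pivot : {G G′ : Graph n} {p q : Fin n} → IsGcds G p q G′ → adj G p q ≡ true → Isolated G′ p
isolated-gcds-pivot {G = G} {p = p} {q} (isGcds G′≡gcds) p~q t
  rewrite G′≡gcds p t | gcdsAdj-expand G p q p t | irrefl G p | adj-sym G q p | p~q = xor-same (adj G p t)

isolatedSet-gcds : {G G′ : Graph n} {p q : Fin n} → IsGcds G p q G′ → adj G p q ≡ true
  → isolatedSet G ⊂ isolatedSet G′
isolatedSet-gcds {G = G} {G′} {p} {q} gcds p~q =
    (λ s∈isolatedSet → isolated⇒∈isolatedSet G′ (isolated-gcds gcds (∈isolatedSet⇒isolated G s∈isolatedSet)))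
  , p
  , isolated⇒∈isolatedSet G′ (isolated-gcds-pivot gcds p~q)
  , λ p∈isolatedSet → not-¬ p~q (∈isolatedSet⇒isolated G p∈isolatedSet q)

module _ {x y : Fin n} (x≢y : x ≢ y) where

  root-or-nonRoot : ∀ v → v ≡ x ⊎ v ≡ y ⊎ NonRoot x y v
  root-or-nonRoot v with v ≟ x | v ≟ y
  ... | yes v≡x | _       = inj₁ v≡x
  ... | no  _   | yes v≡y = inj₂ (inj₁ v≡y)
  ... | no  v≢x | no  v≢y = inj₂ (inj₂ (v≢x , v≢y))

  neighbourSum-onRoots : (G : Graph n) (s : Fin n) → (∀ t → NonRoot x y t → adj G s t ≡ false)
    → (c : Fin n → Bool) → neighbourSum G c s ≡ (adj G s x ∧ c x) xor (adj G s y ∧ c y)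
  neighbourSum-onRoots G s noInnerNeighbour c =
    ∑-supportedOn₂ x≢y (λ t → adj G s t ∧ c t)
      (λ t t≢x t≢y → cong (_∧ c t) (noInnerNeighbour t (t≢x , t≢y)))

  InnerEdge : Graph n → Set
  InnerEdge G = ∃ λ p → ∃ λ q → NonRoot x y p × NonRoot x y q × adj G p q ≡ true

  innerEdge? : (G : Graph n) → Dec (InnerEdge G)
  innerEdge? G = any? λ p → any? λ q → nonRoot? p ×-dec nonRoot? q ×-dec adj G p q ≟ᵇ true
    where
    nonRoot? : Decidable (NonRoot x y)
    nonRoot? v = ¬? (v ≟ x) ×-dec ¬? (v ≟ y)

  edgeless-if-noInnerEdge : (G : Graph n) → InKernel G (const true) → KernelSeparates G x y
    → ¬ InnerEdge G → Edgeless G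
  edgeless-if-noInnerEdge G ones∈kernel (c , c∈kernel , cx , cy) ¬innerEdge = edgeless
    where
    noInnerEdge : ∀ s t → NonRoot x y s → NonRoot x y t → adj G s t ≡ false
    noInnerEdge s t s-nonRoot t-nonRoot = ¬-not λ s~t → ¬innerEdge (s , t , s-nonRoot , t-nonRoot , s~t)

    bothFalse : ∀ u v → (u ∧ true) xor (v ∧ true) ≡ false → (u ∧ false) xor (v ∧ true) ≡ false
      → u ≡ false × v ≡ false
    bothFalse false false _ _ = refl , refl
    bothFalse true  true  _ ()
    bothFalse false true  () _
    bothFalse true  false () _

    nonRoot≁roots : ∀ s → NonRoot x y s → adj G s x ≡ false × adj G s y ≡ false
    nonRoot≁roots s nonRoot = bothFalse (adj G s x) (adj G s y) evenDegree balancedCut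
      where
      onRoots : (d : Fin n → Bool) → neighbourSum G d s ≡ (adj G s x ∧ d x) xor (adj G s y ∧ d y)
      onRoots = neighbourSum-onRoots G s (λ t → noInnerEdge s t nonRoot)
      evenDegree : (adj G s x ∧ true) xor (adj G s y ∧ true) ≡ false
      evenDegree = sym (onRoots (const true)) ⟨ trans ⟩ ones∈kernel s
      balancedCut : (adj G s x ∧ false) xor (adj G s y ∧ true) ≡ false
      balancedCut = cong₂ (λ u v → (adj G s x ∧ u) xor (adj G s y ∧ v)) (sym cx) (sym cy) ⟨ trans ⟩
                    sym (onRoots c) ⟨ trans ⟩ c∈kernel s

    nonRoot-isolated : ∀ s → NonRoot x y s → Isolated G s
    nonRoot-isolated s nonRoot t with root-or-nonRoot t
    ... | inj₁ refl            = proj₁ (nonRoot≁roots s nonRoot)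
    ... | inj₂ (inj₁ refl)     = proj₂ (nonRoot≁roots s nonRoot)
    ... | inj₂ (inj₂ nonRoot′) = noInnerEdge s t nonRoot nonRoot′

    x≁y : adj G x y ≡ false
    x≁y = begin
      adj G x y                                          ≡⟨ ∧-identityʳ (adj G x y) ⟨
      (false ∧ true) xor (adj G x y ∧ true)              ≡⟨ cong (λ u → (u ∧ true) xor (adj G x y ∧ true)) (irrefl G x) ⟨
      (adj G x x ∧ true) xor (adj G x y ∧ true)          ≡⟨ neighbourSum-onRoots G x onlyRootNeighbours (const true) ⟨
      neighbourSum G (const true) x                      ≡⟨ ones∈kernel x ⟩
      false                                              ∎
      where
      open ≡-Reasoning
      onlyRootNeighbours : ∀ t → NonRoot x y t → adj G x t ≡ false
      onlyRootNeighbours t nonRoot = adj-sym G x t ⟨ trans ⟩ nonRoot-isolated t nonRoot x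

    edgeless : Edgeless G
    edgeless s t with root-or-nonRoot s | root-or-nonRoot t
    ... | inj₂ (inj₂ nonRoot) | _                   = nonRoot-isolated s nonRoot t
    ... | _                   | inj₂ (inj₂ nonRoot) = adj-sym G s t ⟨ trans ⟩ nonRoot-isolated t nonRoot s
    ... | inj₁ refl           | inj₁ refl           = irrefl G x
    ... | inj₁ refl           | inj₂ (inj₁ refl)    = x≁y
    ... | inj₂ (inj₁ refl)    | inj₁ refl           = adj-sym G y x ⟨ trans ⟩ x≁y
    ... | inj₂ (inj₁ refl)    | inj₂ (inj₁ refl)    = irrefl G y

  KernelSeparates⇒sortable : (G : Graph n) → InKernel G (const true) → KernelSeparates G x y → SortsFrom x y G
  KernelSeparates⇒sortable G = sortFrom G (⊃-wellFounded (isolatedSet G))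
    where
    sortFrom : (H : Graph n) → Acc _⊃_ (isolatedSet H) → InKernel H (const true) → KernelSeparates H x y
      → SortsFrom x y H
    sortFrom H (acc smaller) ones∈kernel separates with innerEdge? H
    ... | no ¬innerEdge = done (edgeless-if-noInnerEdge H ones∈kernel separates ¬innerEdge)
    ... | yes (p , q , (p≢x , p≢y) , (q≢x , q≢y) , p~q) =
      next (step p q p≢x p≢y q≢x q≢y p~q (λ _ _ → refl))
           (sortFrom H′ (smaller (isolatedSet-gcds gcds p~q))
             (InKernel-gcds gcds ones∈kernel) (KernelSeparates-gcds gcds separates))
      where
      H′ : Graph n
      H′ = gcdsGraph H p q
      gcds : IsGcds H p q H′
      gcds = isGcds λ _ _ → refl

mainTheorem7 : ∀ (n : ℕ) (R : TwoRooted n) → Eulerian (graph R)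
    → (GcdsSortable R → PropertyA R) × (PropertyA R → GcdsSortable R)
mainTheorem7 n R eulerian =
    Equivalence.from propertyA⇔separates ∘ sortable⇒KernelSeparates (x≢y R)
  , KernelSeparates⇒sortable (x≢y R) (graph R) ones∈kernel ∘ Equivalence.to propertyA⇔separates
  where
  ones∈kernel : InKernel (graph R) (const true)
  ones∈kernel = eulerian⇒ones∈kernel (graph R) eulerian
  propertyA⇔separates : PropertyA R ⇔ KernelSeparates (graph R) (x R) (y R)
  propertyA⇔separates = propertyA⇔KernelSeparates R ones∈kernel
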